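{- Let $a_1,\ldots,a_n$ be nonnegative integers with $j$ entries equal to $0$, $k$ entries positive and even, and $l$ entries odd, $n=j+k+l$. If $j,k\ge1$ are odd, $l\ge0$ is even, and $k+l\ge3$, then $RT(a_1,\ldots,a_n)$ is super edge-graceful.
   Context: For a finite simple graph $G$ with $p$ vertices and $q$ edges, $G$ is super edge-graceful if there is a bijection $f$ from $E(G)$ onto $\{0,\pm1,\ldots,\pm\frac{q-1}{2}\}$ when $q$ is odd, and onto $\{\pm1,\ldots,\pm\frac{q}{2}\}$ when $q$ is even, such that the induced vertex labeling $f^+(v)=\sum_{uv\in E(G)} f(uv)$ is a bijection from $V(G)$ onto $\{0,\pm1,\ldots,\pm\frac{p-1}{2}\}$ when $p$ is odd, and onto $\{\pm1,\ldots,\pm\frac{p}{2}\}$ when $p$ is even. For nonnegative integers $a_1,\ldots,a_n$, $RT(a_1,\ldots,a_n)$ is the rooted tree with root $v_0$, children $v_1,\ldots,v_n$ of $v_0$, where $v_i$ has exactly $a_i$ children, all of which are leaves. -}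

module Defs where

open import Data.Nat using (ℕ; zero; suc; _+_; _≤_; _%_; _/_)
open import Data.Nat.Properties using () renaming (_≟_ to _≟ℕ_)
open import Data.Integer using (ℤ; ∣_∣; 0ℤ) renaming (_+_ to _+ℤ_)
open import Data.Fin using (Fin; zero; suc; toℕ)
open import Data.List using (List; []; _∷_; length; map; upTo; _++_)
open import Data.Nat.ListAction using (sum)
open import Data.Product using (_×_; _,_; Σ; ∃)
open import Data.Sum using (_⊎_)
open import Relation.Binary.PropositionalEquality using (_≡_; _≢_)
open import Relation.Nullary using (yes; no)
open import Function using (_∘_)
open import Function.Definitions using (Injective)

-- A finite graph: vertices are 0 , … , order-1 ; edges are a list of
-- (unordered) endpoint pairs.  Edge number i is the i-th list entry.
record Graph : Set where
  constructor mkGraph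
  field
    order : ℕ
    edges : List (ℕ × ℕ)

open Graph public

size : Graph → ℕ
size G = length (edges G)

-- The label set {0,±1,…,±(m-1)/2} (m odd) or {±1,…,±m/2} (m even).
LabelSet : ℕ → ℤ → Set
LabelSet m z = (m % 2 ≡ 1 × ∣ z ∣ ≤ m / 2)
             ⊎ (m % 2 ≡ 0 × z ≢ 0ℤ × ∣ z ∣ ≤ m / 2)

BijOntoLabels : (m : ℕ) → (Fin m → ℤ) → Set
BijOntoLabels m g =
  Injective _≡_ _≡_ g
  × (∀ i → LabelSet m (g i))
  × (∀ z → LabelSet m z → ∃ λ i → g i ≡ z)

incSum : (es : List (ℕ × ℕ)) → (Fin (length es) → ℤ) → ℕ → ℤ
incSum [] f v = 0ℤ
incSum ((a , b) ∷ es) f v with v ≟ℕ a | v ≟ℕ b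
... | yes _ | _     = f zero +ℤ incSum es (f ∘ suc) v
... | no _  | yes _ = f zero +ℤ incSum es (f ∘ suc) v
... | no _  | no _  = incSum es (f ∘ suc) v

vertexLabel : (G : Graph) → (Fin (size G) → ℤ) → Fin (order G) → ℤ
vertexLabel G f v = incSum (edges G) f (toℕ v)

SuperEdgeGraceful : Graph → Set
SuperEdgeGraceful G =
  Σ (Fin (size G) → ℤ) λ f →
    BijOntoLabels (size G) f × BijOntoLabels (order G) (vertexLabel G f)

-- RT(a₁,…,aₙ): root 0, children 1,…,n, leaves numbered n+1,… consecutively.
leafEdges : ℕ → ℕ → List ℕ → List (ℕ × ℕ)
leafEdges i next [] = []
leafEdges i next (a ∷ as) =
  map (λ t → (i , next + t)) (upTo a) ++ leafEdges (suc i) (next + a) as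

RT : List ℕ → Graph
RT as = mkGraph (1 + n + sum as)
                (map (λ i → (0 , suc i)) (upTo n) ++ leafEdges 1 (1 + n) as)
  where n = length as

countZero countPosEven countOdd : List ℕ → ℕ
countZero [] = 0
countZero (zero ∷ as) = suc (countZero as)
countZero (suc _ ∷ as) = countZero as
countPosEven [] = 0
countPosEven (zero ∷ as) = countPosEven as
countPosEven (suc a ∷ as) with suc a % 2
... | zero = suc (countPosEven as)
... | suc _ = countPosEven as
countOdd [] = 0
countOdd (a ∷ as) with a % 2
... | zero = countOdd as
... | suc _ = suc (countOdd as)

module Submission where

-- Only parities matter: l = 2R odd and
-- j + k = 2H even children suffice.
--
-- Labels are handled through codes: 2h ↦ h+1 and 2h+1 ↦ -(h+1) number {±1,…,±M} by
-- 0,…,2M-1 (`label`), with an extra code 0 ↦ 0 for vertices (`label₀`); a duplicate-free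
-- list of all codes, read position by position, is a bijection onto the labels
-- (`codes⇒bijection`).  In RT the e-th edge joins vertex e+1 to a smaller parent, so a
-- vertex label is its own edge label plus the labels of the edges to its children
-- (`incidence-attach`).  The labelling (`Scheme`) gives the leaves pairs ±y, one pair to
-- one child; the root edges of even children form pairs ±y as well and equal their
-- vertex labels; the w-th odd child gets root edge ±(2c+1) and an extra leaf ∓2(R-c), so
-- its vertex label ±(4c+1-2R) is again a root edge label (`odd-child-sum`).  Hence the
-- edge codes and the vertex codes both enumerate all codes (`layout`), which gives the
-- two bijections (`RT-super-edge-graceful`); lemma11 only converts the counts.

open import Defs
open import Data.Bool using (Bool; true; false; not)
open import Data.Bool.Properties using (not-injective)
open import Data.Nat using (ℕ; zero; suc; _+_; _*_; _∸_; _≤_; _<_; z≤n; s≤s; z<s; _≤?_; _<?_; _%_; _/_)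
open import Data.Nat.Properties
open import Data.Nat.ListAction using (sum)
open import Data.Nat.DivMod using ([m+kn]%n≡m%n; m*n%n≡0; m*n/n≡m; +-distrib-/; m%n<n; m≡m%n+[m/n]*n)
open import Data.Integer using (ℤ; +_; -[1+_]; 0ℤ; -_; ∣_∣) renaming (_+_ to _+ℤ_)
import Data.Integer.Properties as ℤ
open import Data.Fin using (Fin; zero; suc; toℕ; cast)
open import Data.Fin.Properties using (toℕ-cast; toℕ<n; cast-is-id)
open import Data.List using (List; []; _∷_; length; map; _++_; zip; lookup; foldr; upTo; applyUpTo)
open import Data.List.Properties using (length-++; length-map; map-++; map-∘; ++-assoc; map-upTo)
open import Data.List.Relation.Unary.All as All using (All; []; _∷_)
open import Data.List.Relation.Unary.Any using (here; there; index)
open import Data.List.Relation.Unary.Any.Properties using (lookup-index)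
open import Data.List.Membership.Propositional using (_∈_)
open import Data.List.Membership.Propositional.Properties using (∈-∃++; ∈-lookup; ∈-map⁻; ∈-++⁻)
open import Data.List.Membership.DecPropositional _≟_ using (_∈?_)
open import Data.List.Relation.Unary.Unique.Propositional using (Unique)
open import Data.List.Relation.Unary.All.Properties using () renaming (map⁺ to All-map⁺)
open import Data.List.Relation.Unary.Unique.Propositional.Properties using (++⁺) renaming (map⁺ to unique-map⁺)
open import Data.List.Relation.Unary.AllPairs using ([]; _∷_)
open import Data.List.Relation.Binary.Permutation.Propositional using (_↭_; ↭⇒↭ₛ; ↭-refl; ↭-sym; ↭-trans; ↭-reflexive; prep)
open import Data.List.Relation.Binary.Permutation.Setoid.Properties using (foldr-commMonoid) renaming (Unique-resp-↭ to Unique-resp-↭ₛ)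
open import Data.List.Relation.Binary.Permutation.Propositional.Properties
  using (shift; shifts; ++⁺ˡ; ∈-resp-↭; ↭-length; All-resp-↭) renaming (map⁺ to ↭-map⁺; ++⁺ to ↭-++⁺)
open import Data.Product using (_×_; _,_; proj₁; proj₂; ∃)
open import Data.Sum using (inj₁; inj₂)
open import Data.Empty using (⊥-elim)
open import Relation.Nullary using (¬_; yes; no)
open import Relation.Binary.PropositionalEquality
open import Data.Nat.Tactic.RingSolver using (solve-∀)

-- Lists of consecutive numbers and a pigeonhole principle for them.

range : ℕ → ℕ → List ℕ
range s zero    = []
range s (suc k) = s ∷ range (suc s) k

length-range : ∀ s k → length (range s k) ≡ k
length-range s zero    = refl
length-range s (suc k) = cong suc (length-range (suc s) k)

∈-range⁺ : ∀ {s k x} → s ≤ x → x < s + k → x ∈ range s k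
∈-range⁺ {s} {zero}  s≤x x<s+0 = ⊥-elim (<⇒≱ (subst (_ <_) (+-identityʳ s) x<s+0) s≤x)
∈-range⁺ {s} {suc k} {x} s≤x x<s+k with s ≟ x
... | yes refl = here refl
... | no  s≢x  = there (∈-range⁺ (≤∧≢⇒< s≤x s≢x) (subst (x <_) (+-suc s k) x<s+k))

∈-range⁻ : ∀ {s k x} → x ∈ range s k → s ≤ x × x < s + k
∈-range⁻ {s} {suc k} (here refl) = ≤-refl , m<m+n s z<s
∈-range⁻ {s} {suc k} {x} (there x∈) =
  let s<x , x<1+s+k = ∈-range⁻ x∈ in <⇒≤ s<x , subst (x <_) (sym (+-suc s k)) x<1+s+k

range-unique : ∀ s k → Unique (range s k)
range-unique s zero    = []
range-unique s (suc k) = All.tabulate (λ x∈ s≡x → <⇒≢ (proj₁ (∈-range⁻ x∈)) s≡x) ∷ range-unique (suc s) k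

range-++ : ∀ s k k′ → range s k ++ range (s + k) k′ ≡ range s (k + k′)
range-++ s zero    k′ = cong (λ x → range x k′) (+-identityʳ s)
range-++ s (suc k) k′ = cong (s ∷_) (trans (cong (λ x → range (suc s) k ++ range x k′) (+-suc s k)) (range-++ (suc s) k k′))

remove : ∀ {A : Set} {x : A} {ys} → x ∈ ys → ∃ λ zs → ys ↭ x ∷ zs
remove x∈ys with ∈-∃++ x∈ys
... | as , bs , refl = as ++ bs , shift _ as bs

∈-∷⁻ : ∀ {A : Set} {x y : A} {zs} → y ∈ x ∷ zs → y ≢ x → y ∈ zs
∈-∷⁻ (here y≡x) y≢x = ⊥-elim (y≢x y≡x)
∈-∷⁻ (there y∈) _   = y∈

unique-length-≤ : ∀ {A : Set} {xs ys : List A} → Unique xs → (∀ {x} → x ∈ xs → x ∈ ys) → length xs ≤ length ys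
unique-length-≤ {xs = []}     _              _     = z≤n
unique-length-≤ {xs = x ∷ xs} (x∉xs ∷ uxs) xs⊆ys with remove (xs⊆ys (here refl))
... | zs , ys↭x∷zs = subst (suc (length xs) ≤_) (sym (↭-length ys↭x∷zs)) (s≤s (unique-length-≤ uxs xs⊆zs))
  where
  xs⊆zs : ∀ {y} → y ∈ xs → y ∈ zs
  xs⊆zs y∈xs = ∈-∷⁻ (∈-resp-↭ ys↭x∷zs (xs⊆ys (there y∈xs))) (λ y≡x → All.lookup x∉xs y∈xs (sym y≡x))

unique-enumerates : ∀ (xs : List ℕ) → Unique xs → All (_< length xs) xs → ∀ {k} → k < length xs → k ∈ xs
unique-enumerates xs uxs bounded {k} k<m with k ∈? xs
... | yes k∈xs = k∈xs
... | no  k∉xs with remove (∈-range⁺ {0} z≤n k<m)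
...   | zs , range↭k∷zs = ⊥-elim (<-irrefl refl (begin-strict
          length xs               ≤⟨ unique-length-≤ uxs xs⊆zs ⟩
          length zs               <⟨ n<1+n (length zs) ⟩
          suc (length zs)         ≡⟨ ↭-length range↭k∷zs ⟨
          length (range 0 (length xs)) ≡⟨ length-range 0 (length xs) ⟩
          length xs               ∎))
  where
  open ≤-Reasoning
  xs⊆zs : ∀ {x} → x ∈ xs → x ∈ zs
  xs⊆zs x∈xs = ∈-∷⁻ (∈-resp-↭ range↭k∷zs (∈-range⁺ z≤n (All.lookup bounded x∈xs))) (λ x≡k → k∉xs (subst (_∈ xs) x≡k x∈xs))

unique-resp-↭ : ∀ {xs ys : List ℕ} → xs ↭ ys → Unique xs → Unique ys
unique-resp-↭ p = Unique-resp-↭ₛ (setoid ℕ) (↭⇒↭ₛ p)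

unique-map : ∀ {A B : Set} (f : A → B) {xs} → (∀ {x y} → x ∈ xs → y ∈ xs → f x ≡ f y → x ≡ y) → Unique xs → Unique (map f xs)
unique-map f {[]}     _   []           = []
unique-map f {x ∷ xs} inj (x∉xs ∷ uxs) =
  All.tabulate fx∉ ∷ unique-map f (λ x∈ y∈ → inj (there x∈) (there y∈)) uxs
  where
  fx∉ : ∀ {v} → v ∈ map f xs → f x ≢ v
  fx∉ v∈ fx≡v with ∈-map⁻ f v∈
  ... | y , y∈xs , refl = All.lookup x∉xs y∈xs (inj (here refl) (there y∈xs) fx≡v)

unique-++-separated : ∀ {xs ys t} → Unique xs → Unique ys → All (_< t) xs → All (t ≤_) ys → Unique (xs ++ ys)
unique-++-separated uxs uys xs<t t≤ys = ++⁺ uxs uys (λ (v∈xs , v∈ys) → <⇒≱ (All.lookup xs<t v∈xs) (All.lookup t≤ys v∈ys))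

unique-lookup-injective : ∀ {A : Set} (L : List A) → Unique L → ∀ {i j} → lookup L i ≡ lookup L j → i ≡ j
unique-lookup-injective (x ∷ L) _          {zero}  {zero}  _  = refl
unique-lookup-injective (x ∷ L) (x∉L ∷ _) {zero}  {suc j} eq = ⊥-elim (All.lookup x∉L (∈-lookup j) eq)
unique-lookup-injective (x ∷ L) (x∉L ∷ _) {suc i} {zero}  eq = ⊥-elim (All.lookup x∉L (∈-lookup i) (sym eq))
unique-lookup-injective (x ∷ L) (_ ∷ uL)   {suc i} {suc j} eq = cong suc (unique-lookup-injective L uL eq)

applyUpTo-cong : ∀ {A : Set} {f g : ℕ → A} → (∀ t → f t ≡ g t) → ∀ n → applyUpTo f n ≡ applyUpTo g n
applyUpTo-cong f≗g zero    = refl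
applyUpTo-cong f≗g (suc n) = cong₂ _∷_ (f≗g 0) (applyUpTo-cong (λ t → f≗g (suc t)) n)

at : ∀ {A : Set} → A → List A → ℕ → A
at d []       k       = d
at d (x ∷ xs) zero    = x
at d (x ∷ xs) (suc k) = at d xs k

at-++ˡ : ∀ {A : Set} {d : A} xs ys {k} → k < length xs → at d (xs ++ ys) k ≡ at d xs k
at-++ˡ (x ∷ xs) ys {zero}  _          = refl
at-++ˡ (x ∷ xs) ys {suc k} (s≤s k<n) = at-++ˡ xs ys k<n

at-++ʳ : ∀ {A : Set} {d : A} xs ys k → at d (xs ++ ys) (length xs + k) ≡ at d ys k
at-++ʳ []       ys k = refl
at-++ʳ (x ∷ xs) ys k = at-++ʳ xs ys k

at-map : ∀ {A B : Set} {d : A} {e : B} (f : A → B) xs {k} → k < length xs → at e (map f xs) k ≡ f (at d xs k)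
at-map f (x ∷ xs) {zero}  _          = refl
at-map f (x ∷ xs) {suc k} (s≤s k<n) = at-map f xs k<n

at-lookup : ∀ {A : Set} {d : A} (xs : List A) i → at d xs (toℕ i) ≡ lookup xs i
at-lookup (x ∷ xs) zero    = refl
at-lookup (x ∷ xs) (suc i) = at-lookup xs i

sumℤ : List ℤ → ℤ
sumℤ = foldr _+ℤ_ 0ℤ

sumℤ-++ : ∀ xs ys → sumℤ (xs ++ ys) ≡ sumℤ xs +ℤ sumℤ ys
sumℤ-++ []       ys = sym (ℤ.+-identityˡ _)
sumℤ-++ (x ∷ xs) ys = trans (cong (x +ℤ_) (sumℤ-++ xs ys)) (sym (ℤ.+-assoc x _ _))

sumℤ-↭ : ∀ {xs ys} → xs ↭ ys → sumℤ xs ≡ sumℤ ys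
sumℤ-↭ p = foldr-commMonoid (setoid ℤ) ℤ.+-0-isCommutativeMonoid (↭⇒↭ₛ p)

-- Codes for labels.  A code k = b + 2h (b a bit) stands for the label ±(h+1), with the
-- sign given by b; thus the codes 0,1,…,2M-1 are a bijective numbering of {±1,…,±M}.
-- Adding the code 0 for the label 0 in front numbers {0,±1,…,±M} by 0,…,2M.

bit : Bool → ℕ
bit false = 0
bit true  = 1

data Parity : ℕ → Set where
  parity : (b : Bool) (h : ℕ) → Parity (bit b + h * 2)

parity? : ∀ n → Parity n
parity? zero          = parity false 0
parity? (suc zero)    = parity true 0
parity? (suc (suc n)) with parity? n
... | parity false h = parity false (suc h)
... | parity true  h = parity true  (suc h)

parity?-unique : ∀ b h → parity? (bit b + h * 2) ≡ parity b h
parity?-unique false zero    = refl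
parity?-unique true  zero    = refl
parity?-unique false (suc h) rewrite parity?-unique false h = refl
parity?-unique true  (suc h) rewrite parity?-unique true  h = refl

signed : Bool → ℤ → ℤ
signed false z = z
signed true  z = - z

signed-+ : ∀ b x y → signed b x +ℤ signed b y ≡ signed b (x +ℤ y)
signed-+ false x y = refl
signed-+ true  x y = sym (ℤ.neg-distrib-+ x y)

signed-not : ∀ b z → signed (not b) z ≡ signed b (- z)
signed-not false z = refl
signed-not true  z = sym (ℤ.neg-involutive z)

label : ℕ → ℤ
label k with parity? k
... | parity b h = signed b (+ suc h)

label-parity : ∀ b h → label (bit b + h * 2) ≡ signed b (+ suc h)
label-parity b h rewrite parity?-unique b h = refl

signed-injective : ∀ b b′ h h′ → signed b (+ suc h) ≡ signed b′ (+ suc h′) → b ≡ b′ × h ≡ h′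
signed-injective false false h .h refl = refl , refl
signed-injective true  true  h .h refl = refl , refl

label-injective : ∀ {k k′} → label k ≡ label k′ → k ≡ k′
label-injective {k} {k′} eq with parity? k | parity? k′
... | parity b h | parity b′ h′ with signed-injective b b′ h h′ eq
...   | refl , refl = refl

label≢0 : ∀ k → label k ≢ 0ℤ
label≢0 k with parity? k
... | parity false h = λ ()
... | parity true  h = λ ()

label-bound : ∀ {M} k → k < M * 2 → ∣ label k ∣ ≤ M
label-bound {M} k k<2M with parity? k
... | parity b h = subst (_≤ M) (sym (∣signed∣ b)) (*-cancelʳ-< 2 h M (≤-<-trans (m≤n+m (h * 2) (bit b)) k<2M))
  where
  ∣signed∣ : ∀ b → ∣ signed b (+ suc h) ∣ ≡ suc h
  ∣signed∣ false = refl
  ∣signed∣ true  = refl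

code : ℤ → ℕ
code (+ zero)  = 0
code (+ suc h) = h * 2
code -[1+ h ]  = suc (h * 2)

label-code : ∀ z → z ≢ 0ℤ → label (code z) ≡ z
label-code (+ zero)  z≢0 = ⊥-elim (z≢0 refl)
label-code (+ suc h) _   = label-parity false h
label-code -[1+ h ]  _   = label-parity true h

code-bound : ∀ {M} z → z ≢ 0ℤ → ∣ z ∣ ≤ M → code z < M * 2
code-bound (+ zero)  z≢0 _     = ⊥-elim (z≢0 refl)
code-bound (+ suc h) _   1+h≤M = *-monoˡ-< 2 1+h≤M
code-bound -[1+ h ]  _   1+h≤M = *-monoˡ-≤ 2 1+h≤M

label₀ : ℕ → ℤ
label₀ zero    = 0ℤ
label₀ (suc k) = label k

code₀ : ℤ → ℕ
code₀ (+ zero) = 0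
code₀ z@(+ suc _) = suc (code z)
code₀ z@(-[1+ _ ]) = suc (code z)

label₀-code₀ : ∀ z → label₀ (code₀ z) ≡ z
label₀-code₀ (+ zero)  = refl
label₀-code₀ (+ suc h) = label-parity false h
label₀-code₀ -[1+ h ]  = label-parity true h

label₀-injective : ∀ {k k′} → label₀ k ≡ label₀ k′ → k ≡ k′
label₀-injective {zero}  {zero}   _  = refl
label₀-injective {zero}  {suc k′} eq = ⊥-elim (label≢0 k′ (sym eq))
label₀-injective {suc k} {zero}   eq = ⊥-elim (label≢0 k eq)
label₀-injective {suc k} {suc k′} eq = cong suc (label-injective eq)

record Coding (m : ℕ) (D : ℕ → ℤ) : Set where
  field
    injective : ∀ {k k′} → D k ≡ D k′ → k ≡ k′
    into      : ∀ {k} → k < m → LabelSet m (D k)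
    onto      : ∀ z → LabelSet m z → ∃ λ k → k < m × D k ≡ z

even%2 : ∀ M → M * 2 % 2 ≡ 0
even%2 M = m*n%n≡0 M 2

odd%2 : ∀ M → suc (M * 2) % 2 ≡ 1
odd%2 M = [m+kn]%n≡m%n 1 M 2

even/2 : ∀ M → M * 2 / 2 ≡ M
even/2 M = m*n/n≡m M 2

odd/2 : ∀ M → suc (M * 2) / 2 ≡ M
odd/2 M = trans (+-distrib-/ 1 (M * 2) (subst (λ r → 1 + r < 2) (sym (even%2 M)) (s≤s (s≤s z≤n)))) (even/2 M)

label-coding : ∀ M → Coding (M * 2) label
label-coding M = record
  { injective = label-injective
  ; into      = λ {k} k<2M → inj₂ (even%2 M , label≢0 k , subst (∣ label k ∣ ≤_) (sym (even/2 M)) (label-bound k k<2M))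
  ; onto      = onto
  }
  where
  onto : ∀ z → LabelSet (M * 2) z → ∃ λ k → k < M * 2 × label k ≡ z
  onto z (inj₁ (odd , _))          = ⊥-elim (0≢1+n (trans (sym (even%2 M)) odd))
  onto z (inj₂ (_ , z≢0 , ∣z∣≤M)) = code z , code-bound z z≢0 (subst (∣ z ∣ ≤_) (even/2 M) ∣z∣≤M) , label-code z z≢0

label₀-coding : ∀ M → Coding (suc (M * 2)) label₀
label₀-coding M = record { injective = label₀-injective ; into = into ; onto = onto }
  where
  into : ∀ {k} → k < suc (M * 2) → LabelSet (suc (M * 2)) (label₀ k)
  into {zero}  _           = inj₁ (odd%2 M , z≤n)
  into {suc k} (s≤s k<2M) = inj₁ (odd%2 M , subst (∣ label k ∣ ≤_) (sym (odd/2 M)) (label-bound k k<2M))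
  onto : ∀ z → LabelSet (suc (M * 2)) z → ∃ λ k → k < suc (M * 2) × label₀ k ≡ z
  onto z (inj₂ (even , _)) = ⊥-elim (0≢1+n (trans (sym even) (odd%2 M)))
  onto z (inj₁ (_ , ∣z∣≤M)) = code₀ z , bound z (subst (∣ z ∣ ≤_) (odd/2 M) ∣z∣≤M) , label₀-code₀ z
    where
    bound : ∀ z → ∣ z ∣ ≤ M → code₀ z < suc (M * 2)
    bound (+ zero)    _     = s≤s z≤n
    bound z@(+ suc _) ∣z∣≤M = s≤s (code-bound z (λ ()) ∣z∣≤M)
    bound z@(-[1+ _ ]) ∣z∣≤M = s≤s (code-bound z (λ ()) ∣z∣≤M)

⟨_,_⟩ : Bool → ℕ → ℕ
⟨ b , h ⟩ = bit b + h * 2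

⟨⟩-injective : ∀ b b′ h h′ → ⟨ b , h ⟩ ≡ ⟨ b′ , h′ ⟩ → b ≡ b′ × h ≡ h′
⟨⟩-injective b b′ h h′ eq =
  signed-injective b b′ h h′ (trans (sym (label-parity b h)) (trans (cong label eq) (label-parity b′ h′)))

⟨⟩-bound : ∀ {M} b h → h < M → ⟨ b , h ⟩ < M * 2
⟨⟩-bound {M} b h h<M = ≤-trans (+-monoˡ-≤ (h * 2) (bit≤1 b)) (*-monoˡ-≤ 2 h<M)
  where
  bit≤1 : ∀ b → bit b < 2
  bit≤1 false = s≤s z≤n
  bit≤1 true  = s≤s (s≤s z≤n)

paired-sum : ∀ (G : ℕ → ℕ) → (∀ x → label (G ⟨ true , x ⟩) ≡ - label (G ⟨ false , x ⟩)) →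
             ∀ c k → sumℤ (map (λ k → label (G k)) (range (c * 2) (k * 2))) ≡ 0ℤ
paired-sum G opposite c zero    = refl
paired-sum G opposite c (suc k) = begin
  y +ℤ (label (G (suc (c * 2))) +ℤ rest)  ≡⟨ cong (λ z → y +ℤ (z +ℤ rest)) (opposite c) ⟩
  y +ℤ (- y +ℤ rest)                      ≡⟨ cong (λ z → y +ℤ (- y +ℤ z)) (paired-sum G opposite (suc c) k) ⟩
  y +ℤ (- y +ℤ 0ℤ)                        ≡⟨ cong (y +ℤ_) (ℤ.+-identityʳ (- y)) ⟩
  y +ℤ - y                                ≡⟨ ℤ.+-inverseʳ y ⟩
  0ℤ                                      ∎
  where
  open ≡-Reasoning
  y : ℤ
  y = label (G (c * 2))
  rest : ℤ
  rest = sumℤ (map (λ k → label (G k)) (range (suc c * 2) (k * 2)))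

-- The labels of the codes 2x, …, 2x+2h-1 are h pairs ±y, so they sum to zero.
range-sum : ∀ x h → sumℤ (map label (range (x * 2) (h * 2))) ≡ 0ℤ
range-sum = paired-sum (λ k → k) (λ x → trans (label-parity true x) (cong -_ (sym (label-parity false x))))

codes⇒bijection : ∀ {m D} → Coding m D → (L : List ℕ) (m≡ : m ≡ length L) → Unique L → All (_< m) L →
                  BijOntoLabels m (λ i → D (lookup L (cast m≡ i)))
codes⇒bijection {D = D} coding L refl uL L<m = injective , into , onto
  where
  module C = Coding coding
  uncast : ∀ i → lookup L (cast refl i) ≡ lookup L i
  uncast i = cong (lookup L) (cast-is-id refl i)
  injective : ∀ {i j} → D (lookup L (cast refl i)) ≡ D (lookup L (cast refl j)) → i ≡ j
  injective {i} {j} eq = unique-lookup-injective L uL (trans (sym (uncast i)) (trans (C.injective eq) (uncast j)))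
  into : ∀ i → LabelSet (length L) (D (lookup L (cast refl i)))
  into i = C.into (All.lookup L<m (∈-lookup (cast refl i)))
  onto : ∀ z → LabelSet (length L) z → ∃ λ i → D (lookup L (cast refl i)) ≡ z
  onto z z∈ with C.onto z z∈
  ... | k , k<m , Dk≡z = index k∈L , trans (cong D (trans (uncast (index k∈L)) (sym (lookup-index k∈L)))) Dk≡z
    where
    k∈L : k ∈ L
    k∈L = unique-enumerates L uL L<m k<m

BijOntoLabels-resp : ∀ {m} {g h : Fin m → ℤ} → (∀ v → h v ≡ g v) → BijOntoLabels m g → BijOntoLabels m h
BijOntoLabels-resp {m} h≗g (injective , into , onto) =
  (λ {x} {y} eq → injective (trans (sym (h≗g x)) (trans eq (h≗g y)))) ,
  (λ i → subst (LabelSet m) (sym (h≗g i)) (into i)) ,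
  (λ z z∈ → let i , gi≡z = onto z z∈ in i , trans (h≗g i) gi≡z)

LabelledEdges : Set
LabelledEdges = List ((ℕ × ℕ) × ℤ)

incidence : LabelledEdges → ℕ → ℤ
incidence [] v = 0ℤ
incidence (((a , b) , z) ∷ es) v with v ≟ a | v ≟ b
... | yes _ | _     = z +ℤ incidence es v
... | no _  | yes _ = z +ℤ incidence es v
... | no _  | no _  = incidence es v

incSum-zip : ∀ es (L : List ℕ) (g : ℕ → ℤ) (eq : length es ≡ length L) v →
             incSum es (λ i → g (lookup L (cast eq i))) v ≡ incidence (zip es (map g L)) v
incSum-zip []               []      g eq v = refl
incSum-zip ((a , b) ∷ es)   (x ∷ L) g eq v with v ≟ a | v ≟ b
... | yes _ | _     = cong (g x +ℤ_) (incSum-zip es L g (suc-injective eq) v)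
... | no _  | yes _ = cong (g x +ℤ_) (incSum-zip es L g (suc-injective eq) v)
... | no _  | no _  = incSum-zip es L g (suc-injective eq) v

-- Parent lists.  A list ps of pairs (p , z) describes labelled edges numbered from s:
-- the i-th entry is the edge joining the parent p to the vertex s + i, labelled z.
-- When every parent precedes its child, the label sum at a vertex v splits into the
-- label of the edge from v to its parent (`ownLabel`) and the labels of the edges
-- to its children (`childSum`).
ParentList : Set
ParentList = List (ℕ × ℤ)

attach : ℕ → ParentList → LabelledEdges
attach s []             = []
attach s ((p , z) ∷ ps) = ((p , s) , z) ∷ attach (suc s) ps

attachedEdges : ℕ → ParentList → List (ℕ × ℕ)
attachedEdges s ps = map proj₁ (attach s ps)

zip-attach : ∀ s ps → zip (attachedEdges s ps) (map proj₂ ps) ≡ attach s ps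
zip-attach s []             = refl
zip-attach s ((p , z) ∷ ps) = cong (((p , s) , z) ∷_) (zip-attach (suc s) ps)

length-attach : ∀ s ps → length (attach s ps) ≡ length ps
length-attach s []       = refl
length-attach s (_ ∷ ps) = cong suc (length-attach (suc s) ps)

ownLabel : ℕ → ParentList → ℕ → ℤ
ownLabel s []             v = 0ℤ
ownLabel s ((p , z) ∷ ps) v with v ≟ s
... | yes _ = z +ℤ ownLabel (suc s) ps v
... | no _  = ownLabel (suc s) ps v

childSum : ParentList → ℕ → ℤ
childSum []             v = 0ℤ
childSum ((p , z) ∷ ps) v with v ≟ p
... | yes _ = z +ℤ childSum ps v
... | no _  = childSum ps v

data ParentsFirst : ℕ → ParentList → Set where
  []  : ∀ {s} → ParentsFirst s []
  _∷_ : ∀ {s p z ps} → p < s → ParentsFirst (suc s) ps → ParentsFirst s ((p , z) ∷ ps)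

ParentsFirst-++ : ∀ {s} ps qs → ParentsFirst s ps → ParentsFirst (s + length ps) qs → ParentsFirst s (ps ++ qs)
ParentsFirst-++ {s} []       qs []         qs-ok = subst (λ x → ParentsFirst x qs) (+-identityʳ s) qs-ok
ParentsFirst-++ {s} (_ ∷ ps) qs (p<s ∷ ok) qs-ok =
  p<s ∷ ParentsFirst-++ ps qs ok (subst (λ x → ParentsFirst x qs) (+-suc s (length ps)) qs-ok)

ParentsFirst-bounded : ∀ {s} ps → All (λ e → proj₁ e < s) ps → ParentsFirst s ps
ParentsFirst-bounded []       []           = []
ParentsFirst-bounded (_ ∷ ps) (p<s ∷ ps<s) = p<s ∷ ParentsFirst-bounded ps (All.map m<n⇒m<1+n ps<s)

incidence-attach : ∀ s ps v → ParentsFirst s ps → incidence (attach s ps) v ≡ ownLabel s ps v +ℤ childSum ps v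
incidence-attach s []             v _ = refl
incidence-attach s ((p , z) ∷ ps) v (p<s ∷ ok) with v ≟ p | v ≟ s
... | yes refl | yes refl = ⊥-elim (<-irrefl refl p<s)
... | yes _    | no _     = begin
      z +ℤ incidence (attach (suc s) ps) v  ≡⟨ cong (z +ℤ_) (incidence-attach (suc s) ps v ok) ⟩
      z +ℤ (own +ℤ childSum ps v)           ≡⟨ ℤ.+-assoc z own _ ⟨
      (z +ℤ own) +ℤ childSum ps v           ≡⟨ cong (_+ℤ childSum ps v) (ℤ.+-comm z own) ⟩
      (own +ℤ z) +ℤ childSum ps v           ≡⟨ ℤ.+-assoc own z _ ⟩
      own +ℤ (z +ℤ childSum ps v)           ∎
  where
  open ≡-Reasoning
  own : ℤ
  own = ownLabel (suc s) ps v
... | no _ | yes _ = trans (cong (z +ℤ_) (incidence-attach (suc s) ps v ok)) (sym (ℤ.+-assoc z _ _))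
... | no _ | no _  = incidence-attach (suc s) ps v ok

ownLabel-before : ∀ s ps v → v < s → ownLabel s ps v ≡ 0ℤ
ownLabel-before s []             v v<s = refl
ownLabel-before s ((p , z) ∷ ps) v v<s with v ≟ s
... | yes refl = ⊥-elim (<-irrefl refl v<s)
... | no _     = ownLabel-before (suc s) ps v (m<n⇒m<1+n v<s)

ownLabel-at : ∀ s ps k → ownLabel s ps (s + k) ≡ at 0ℤ (map proj₂ ps) k
ownLabel-at s []             k = refl
ownLabel-at s ((p , z) ∷ ps) zero with s + 0 ≟ s
... | yes _   = trans (cong (z +ℤ_) (ownLabel-before (suc s) ps (s + 0) (s≤s (≤-reflexive (+-identityʳ s))))) (ℤ.+-identityʳ z)
... | no s≢s = ⊥-elim (s≢s (+-identityʳ s))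
ownLabel-at s ((p , z) ∷ ps) (suc k) with s + suc k ≟ s
... | yes eq = ⊥-elim (m+1+n≢m s eq)
... | no _   = trans (cong (ownLabel (suc s) ps) (+-suc s k)) (ownLabel-at (suc s) ps k)

childSum-++ : ∀ ps qs v → childSum (ps ++ qs) v ≡ childSum ps v +ℤ childSum qs v
childSum-++ []             qs v = sym (ℤ.+-identityˡ _)
childSum-++ ((p , z) ∷ ps) qs v with v ≟ p
... | yes _ = trans (cong (z +ℤ_) (childSum-++ ps qs v)) (sym (ℤ.+-assoc z _ _))
... | no _  = childSum-++ ps qs v

childSum-none : ∀ ps v → All (λ e → proj₁ e ≢ v) ps → childSum ps v ≡ 0ℤ
childSum-none []             v []            = refl
childSum-none ((p , z) ∷ ps) v (p≢v ∷ ps≢v) with v ≟ p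
... | yes v≡p = ⊥-elim (p≢v (sym v≡p))
... | no _    = childSum-none ps v ps≢v

attachedEdges-++ : ∀ s ps qs → attachedEdges s (ps ++ qs) ≡ attachedEdges s ps ++ attachedEdges (s + length ps) qs
attachedEdges-++ s []       qs = cong (λ x → attachedEdges x qs) (sym (+-identityʳ s))
attachedEdges-++ s (e ∷ ps) qs =
  cong (_ ∷_) (trans (attachedEdges-++ (suc s) ps qs) (cong (λ x → attachedEdges (suc s) ps ++ attachedEdges x qs) (sym (+-suc s (length ps)))))

fan : ℕ → List ℤ → ParentList
fan p zs = map (p ,_) zs

childSum-fan : ∀ p zs → childSum (fan p zs) p ≡ sumℤ zs
childSum-fan p []       = refl
childSum-fan p (z ∷ zs) with p ≟ p
... | yes _ = cong (z +ℤ_) (childSum-fan p zs)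
... | no p≢p = ⊥-elim (p≢p refl)

attachedEdges-fan : ∀ s p zs → attachedEdges s (fan p zs) ≡ map (λ t → (p , s + t)) (upTo (length zs))
attachedEdges-fan s p zs = trans (go s zs) (sym (map-upTo _ (length zs)))
  where
  go : ∀ s zs → attachedEdges s (fan p zs) ≡ applyUpTo (λ t → (p , s + t)) (length zs)
  go s []       = refl
  go s (z ∷ zs) = cong₂ _∷_ (cong (p ,_) (sym (+-identityʳ s)))
                    (trans (go (suc s) zs) (applyUpTo-cong (λ t → cong (p ,_) (sym (+-suc s t))) (length zs)))

map-proj₂-fan : ∀ (p : ℕ) (zs : List ℤ) → map proj₂ (fan p zs) ≡ zs
map-proj₂-fan p []       = refl
map-proj₂-fan p (z ∷ zs) = cong (z ∷_) (map-proj₂-fan p zs)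

childSum-fan-other : ∀ p zs v → p ≢ v → childSum (fan p zs) v ≡ 0ℤ
childSum-fan-other p []       v p≢v = refl
childSum-fan-other p (z ∷ zs) v p≢v with v ≟ p
... | yes v≡p = ⊥-elim (p≢v (sym v≡p))
... | no _    = childSum-fan-other p zs v p≢v

-- Odd children.  The w-th odd child, w = ⟨ b , c ⟩ with c < R, gets the root edge
-- label ±(2c+1) and one extra leaf labelled ∓2(R-c); its vertex label is then
-- ±(4c+1-2R).  For w < 2R the root edge labels and the leaf labels make up
-- {±1,…,±2R}, and the vertex labels are again the root edge labels.
module OddChildren (R : ℕ) where

  rootCode leafCode childCode : ℕ → ℕ
  rootCode w with parity? w
  ... | parity b c = ⟨ b , c * 2 ⟩
  leafCode w with parity? w
  ... | parity b c = ⟨ not b , suc ((R ∸ suc c) * 2) ⟩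
  childCode w with parity? w
  ... | parity b c with R ≤? c * 2
  ...   | yes _ = ⟨ b , (c * 2 ∸ R) * 2 ⟩
  ...   | no _  = ⟨ not b , (R ∸ suc (c * 2)) * 2 ⟩

  private
    half< : ∀ b c → ⟨ b , c ⟩ < R * 2 → c < R
    half< b c w<2R = *-cancelʳ-< 2 c R (≤-<-trans (m≤n+m (c * 2) (bit b)) w<2R)

    sum-above : ∀ d e → + suc (suc (d + e) * 2) +ℤ -[1+ suc (d * 2) ] ≡ + suc (e * 2)
    sum-above zero    e = refl
    sum-above (suc d) e = trans (ℤ.[1+m]⊖[1+n]≡m⊖n (suc (suc (suc (d + e) * 2))) (suc (suc (suc (d * 2)))))
                          (trans (ℤ.[1+m]⊖[1+n]≡m⊖n (suc (suc (d + e) * 2)) (suc (suc (d * 2)))) (sum-above d e))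

    sum-below : ∀ c f → + suc (c * 2) +ℤ -[1+ suc ((c + f) * 2) ] ≡ -[1+ f * 2 ]
    sum-below zero    f = refl
    sum-below (suc c) f = trans (ℤ.[1+m]⊖[1+n]≡m⊖n (suc (suc (c * 2))) (suc (suc (suc ((c + f) * 2)))))
                          (trans (ℤ.[1+m]⊖[1+n]≡m⊖n (suc (c * 2)) (suc (suc ((c + f) * 2)))) (sum-below c f))

    root+leaf : ∀ b c d → label ⟨ b , c * 2 ⟩ +ℤ label ⟨ not b , suc (d * 2) ⟩ ≡ signed b (+ suc (c * 2) +ℤ -[1+ suc (d * 2) ])
    root+leaf b c d = trans (cong₂ _+ℤ_ (label-parity b (c * 2)) (trans (label-parity (not b) _) (signed-not b _))) (signed-+ b _ _)

    split-above : ∀ {c} → c < R → R ≤ c * 2 → c ≡ suc ((R ∸ suc c) + (c * 2 ∸ R))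
    split-above {c} c<R R≤2c = +-cancelˡ-≡ c _ _ (begin
      c + c                            ≡⟨ double c ⟩
      c * 2                            ≡⟨ m+[n∸m]≡n R≤2c ⟨
      R + e                            ≡⟨ cong (_+ e) (m+[n∸m]≡n c<R) ⟨
      suc c + d + e                    ≡⟨ shuffle c d e ⟩
      c + suc (d + e)                  ∎)
      where
      open ≡-Reasoning
      d : ℕ
      d = R ∸ suc c
      e : ℕ
      e = c * 2 ∸ R
      double : ∀ c → c + c ≡ c * 2
      double = solve-∀
      shuffle : ∀ c d e → suc c + d + e ≡ c + suc (d + e)
      shuffle = solve-∀

    split-below : ∀ {c} → c * 2 < R → R ∸ suc c ≡ c + (R ∸ suc (c * 2))
    split-below {c} 2c<R = +-cancelˡ-≡ (suc c) _ _ (begin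
      suc c + d                        ≡⟨ m+[n∸m]≡n (≤-trans (s≤s (m≤m+n c c)) (≤-trans (≤-reflexive (cong suc (double c))) 2c<R)) ⟩
      R                                ≡⟨ m+[n∸m]≡n 2c<R ⟨
      suc (c * 2) + f                  ≡⟨ shuffle c f ⟩
      suc c + (c + f)                  ∎)
      where
      open ≡-Reasoning
      d : ℕ
      d = R ∸ suc c
      f : ℕ
      f = R ∸ suc (c * 2)
      double : ∀ c → c + c ≡ c * 2
      double = solve-∀
      shuffle : ∀ c f → suc (c * 2) + f ≡ suc c + (c + f)
      shuffle = solve-∀

  odd-child-sum : ∀ w → w < R * 2 → label (rootCode w) +ℤ label (leafCode w) ≡ label (childCode w)
  odd-child-sum w w<2R with parity? w
  ... | parity b c with R ≤? c * 2
  ...   | yes R≤2c = begin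
      label ⟨ b , c * 2 ⟩ +ℤ label ⟨ not b , suc (d * 2) ⟩
        ≡⟨ root+leaf b c d ⟩
      signed b (+ suc (c * 2) +ℤ -[1+ suc (d * 2) ])
        ≡⟨ cong (λ x → signed b (+ suc (x * 2) +ℤ -[1+ suc (d * 2) ])) (split-above c<R R≤2c) ⟩
      signed b (+ suc (suc (d + e) * 2) +ℤ -[1+ suc (d * 2) ])
        ≡⟨ cong (signed b) (sum-above d e) ⟩
      signed b (+ suc (e * 2))
        ≡⟨ label-parity b (e * 2) ⟨
      label ⟨ b , e * 2 ⟩ ∎
    where
    open ≡-Reasoning
    c<R : c < R
    c<R = half< b c w<2R
    d : ℕ
    d = R ∸ suc c
    e : ℕ
    e = c * 2 ∸ R
  ...   | no R≰2c = begin
      label ⟨ b , c * 2 ⟩ +ℤ label ⟨ not b , suc (d * 2) ⟩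
        ≡⟨ root+leaf b c d ⟩
      signed b (+ suc (c * 2) +ℤ -[1+ suc (d * 2) ])
        ≡⟨ cong (λ x → signed b (+ suc (c * 2) +ℤ -[1+ suc (x * 2) ])) (split-below (≰⇒> R≰2c)) ⟩
      signed b (+ suc (c * 2) +ℤ -[1+ suc ((c + f) * 2) ])
        ≡⟨ cong (signed b) (sum-below c f) ⟩
      signed b (- + suc (f * 2))
        ≡⟨ signed-not b _ ⟨
      signed (not b) (+ suc (f * 2))
        ≡⟨ label-parity (not b) (f * 2) ⟨
      label ⟨ not b , f * 2 ⟩ ∎
    where
    open ≡-Reasoning
    d : ℕ
    d = R ∸ suc c
    f : ℕ
    f = R ∸ suc (c * 2)

  private
    R∸suc< : ∀ x → x < R → R ∸ suc x < R
    R∸suc< x x<R = ∸-monoʳ-< {o = 0} (s≤s z≤n) x<R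

    double< : ∀ x → x < R → x * 2 < R * 2
    double< x = *-monoˡ-< 2

    double≢odd : ∀ x y → x * 2 ≢ suc (y * 2)
    double≢odd x y eq with ⟨⟩-injective false true x y eq
    ... | ()

    -- Codes of root edges and vertices have even magnitude index, extra leaves odd.
    evenMag≢oddMag : ∀ b b′ x y → ⟨ b , x * 2 ⟩ ≢ ⟨ b′ , suc (y * 2) ⟩
    evenMag≢oddMag b b′ x y eq = double≢odd x y (proj₂ (⟨⟩-injective b b′ (x * 2) (suc (y * 2)) eq))

    -- In the two cases of childCode the magnitudes 2c - R and R - (2c′+1) never agree,
    -- as they have different parity after adding R.
    above≢below : ∀ {c c′} → R ≤ c * 2 → c′ * 2 < R → c * 2 ∸ R ≢ R ∸ suc (c′ * 2)
    above≢below {c} {c′} R≤2c 2c′<R eq = double≢odd c (c′ + e) (begin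
      c * 2                     ≡⟨ m+[n∸m]≡n R≤2c ⟨
      R + e                     ≡⟨ cong (_+ e) (m+[n∸m]≡n 2c′<R) ⟨
      suc (c′ * 2) + f + e      ≡⟨ cong (λ x → suc (c′ * 2) + x + e) eq ⟨
      suc (c′ * 2) + e + e      ≡⟨ shuffle c′ e ⟩
      suc ((c′ + e) * 2)        ∎)
      where
      open ≡-Reasoning
      e : ℕ
      e = c * 2 ∸ R
      f : ℕ
      f = R ∸ suc (c′ * 2)
      shuffle : ∀ c′ e → suc (c′ * 2) + e + e ≡ suc ((c′ + e) * 2)
      shuffle = solve-∀

  rootCode-injective : ∀ {w w′} → rootCode w ≡ rootCode w′ → w ≡ w′
  rootCode-injective {w} {w′} eq with parity? w | parity? w′
  ... | parity b c | parity b′ c′ with ⟨⟩-injective b b′ (c * 2) (c′ * 2) eq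
  ...   | refl , 2c≡2c′ = cong (λ x → ⟨ b , x ⟩) (*-cancelʳ-≡ c c′ 2 2c≡2c′)

  leafCode-injective : ∀ {w w′} → w < R * 2 → w′ < R * 2 → leafCode w ≡ leafCode w′ → w ≡ w′
  leafCode-injective {w} {w′} w< w′< eq with parity? w | parity? w′
  ... | parity b c | parity b′ c′ with ⟨⟩-injective (not b) (not b′) (suc ((R ∸ suc c) * 2)) (suc ((R ∸ suc c′) * 2)) eq
  ...   | nb≡nb′ , d≡d′ = cong₂ ⟨_,_⟩ (not-injective nb≡nb′)
          (suc-injective (∸-cancelˡ-≡ (half< b c w<) (half< b′ c′ w′<) (*-cancelʳ-≡ _ _ 2 (suc-injective d≡d′))))

  childCode-injective : ∀ {w w′} → w < R * 2 → w′ < R * 2 → childCode w ≡ childCode w′ → w ≡ w′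
  childCode-injective {w} {w′} w< w′< eq with parity? w | parity? w′
  ... | parity b c | parity b′ c′ with R ≤? c * 2 | R ≤? c′ * 2
  ...   | yes R≤2c | yes R≤2c′ with ⟨⟩-injective b b′ ((c * 2 ∸ R) * 2) ((c′ * 2 ∸ R) * 2) eq
  ...     | refl , e≡e′ = cong (λ x → ⟨ b , x ⟩) (*-cancelʳ-≡ c c′ 2 (∸-cancelʳ-≡ R≤2c R≤2c′ (*-cancelʳ-≡ _ _ 2 e≡e′)))
  childCode-injective w< w′< eq | parity b c | parity b′ c′ | no R≰2c | no R≰2c′
    with ⟨⟩-injective (not b) (not b′) ((R ∸ suc (c * 2)) * 2) ((R ∸ suc (c′ * 2)) * 2) eq
  ...     | nb≡nb′ , f≡f′ = cong₂ ⟨_,_⟩ (not-injective nb≡nb′)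
            (*-cancelʳ-≡ c c′ 2 (suc-injective (∸-cancelˡ-≡ (≰⇒> R≰2c) (≰⇒> R≰2c′) (*-cancelʳ-≡ _ _ 2 f≡f′))))
  childCode-injective w< w′< eq | parity b c | parity b′ c′ | yes R≤2c | no R≰2c′ =
    ⊥-elim (above≢below {c} {c′} R≤2c (≰⇒> R≰2c′)
      (*-cancelʳ-≡ _ _ 2 (proj₂ (⟨⟩-injective b (not b′) ((c * 2 ∸ R) * 2) ((R ∸ suc (c′ * 2)) * 2) eq))))
  childCode-injective w< w′< eq | parity b c | parity b′ c′ | no R≰2c | yes R≤2c′ =
    ⊥-elim (above≢below {c′} {c} R≤2c′ (≰⇒> R≰2c)
      (*-cancelʳ-≡ _ _ 2 (sym (proj₂ (⟨⟩-injective (not b) b′ ((R ∸ suc (c * 2)) * 2) ((c′ * 2 ∸ R) * 2) eq)))))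

  rootCode≢leafCode : ∀ w w′ → rootCode w ≢ leafCode w′
  rootCode≢leafCode w w′ with parity? w | parity? w′
  ... | parity b c | parity b′ c′ = evenMag≢oddMag b (not b′) c (R ∸ suc c′)

  childCode≢leafCode : ∀ w w′ → childCode w ≢ leafCode w′
  childCode≢leafCode w w′ with parity? w | parity? w′
  ... | parity b c | parity b′ c′ with R ≤? c * 2
  ...   | yes _ = evenMag≢oddMag b (not b′) (c * 2 ∸ R) (R ∸ suc c′)
  ...   | no _  = evenMag≢oddMag (not b) (not b′) (R ∸ suc (c * 2)) (R ∸ suc c′)

  rootCode-bound : ∀ {w} → w < R * 2 → rootCode w < R * 2 * 2
  rootCode-bound {w} w< with parity? w
  ... | parity b c = ⟨⟩-bound b (c * 2) (double< c (half< b c w<))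

  leafCode-bound : ∀ {w} → w < R * 2 → leafCode w < R * 2 * 2
  leafCode-bound {w} w< with parity? w
  ... | parity b c = ⟨⟩-bound (not b) (suc ((R ∸ suc c) * 2)) (*-monoˡ-≤ 2 (R∸suc< c (half< b c w<)))

  childCode-bound : ∀ {w} → w < R * 2 → childCode w < R * 2 * 2
  childCode-bound {w} w< with parity? w
  ... | parity b c with R ≤? c * 2
  ...   | yes R≤2c = ⟨⟩-bound b ((c * 2 ∸ R) * 2) (double< (c * 2 ∸ R) e<R)
    where
    double : ∀ R → R * 2 ≡ R + R
    double = solve-∀
    e<R : c * 2 ∸ R < R
    e<R = subst (c * 2 ∸ R <_) (m+n∸n≡m R R) (∸-monoˡ-< (≤-trans (double< c (half< b c w<)) (≤-reflexive (double R))) R≤2c)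
  ...   | no R≰2c = ⟨⟩-bound (not b) ((R ∸ suc (c * 2)) * 2) (double< (R ∸ suc (c * 2)) (R∸suc< (c * 2) (≰⇒> R≰2c)))

oddCount evenCount pairCount : List ℕ → ℕ
oddCount [] = 0
oddCount (a ∷ as) with parity? a
... | parity false _ = oddCount as
... | parity true  _ = suc (oddCount as)
evenCount [] = 0
evenCount (a ∷ as) with parity? a
... | parity false _ = suc (evenCount as)
... | parity true  _ = evenCount as
pairCount [] = 0
pairCount (a ∷ as) with parity? a
... | parity _ h = h + pairCount as

record Counters : Set where
  constructor counters
  field
    odds evens pairs : ℕ
open Counters

start : Counters
start = counters 0 0 0

-- The labelling scheme for 2R odd and 2H even children and P leaf pairs (M = 2R+H+P):
--   codes in [0, 4R)        root edges and extra leaves of the odd children,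
--   codes in [4R, 4R+2H)    root edges of the even children (equal to their vertex labels),
--   codes in [4R+2H, 2M)    leaf pairs ±y, each pair going to the leaves of a single child.
module Scheme (R H : ℕ) where
  open OddChildren R public

  evenBase pairBase : ℕ
  evenBase = R * 2 * 2
  pairBase = R * 2 + H

  -- The code of the edge from the root to a child of size a (F = rootCode), or of the
  -- vertex label of that child (F = childCode).
  topCode : (ℕ → ℕ) → Counters → ℕ → ℕ
  topCode F s a with parity? a
  ... | parity false _ = evens s + evenBase
  ... | parity true  _ = F (odds s)

  leafCodes : Counters → ℕ → List ℕ
  leafCodes s a with parity? a
  ... | parity false h = range ((pairs s + pairBase) * 2) (h * 2)
  ... | parity true  h = leafCode (odds s) ∷ range ((pairs s + pairBase) * 2) (h * 2)

  next : Counters → ℕ → Counters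
  next s a with parity? a
  ... | parity false h = counters (odds s) (suc (evens s)) (pairs s + h)
  ... | parity true  h = counters (suc (odds s)) (evens s) (pairs s + h)

  topCodes : (ℕ → ℕ) → Counters → List ℕ → List ℕ
  topCodes F s []       = []
  topCodes F s (a ∷ as) = topCode F s a ∷ topCodes F (next s a) as

  allLeafCodes : Counters → List ℕ → List ℕ
  allLeafCodes s []       = []
  allLeafCodes s (a ∷ as) = leafCodes s a ++ allLeafCodes (next s a) as

  length-topCodes : ∀ F s as → length (topCodes F s as) ≡ length as
  length-topCodes F s []       = refl
  length-topCodes F s (a ∷ as) = cong suc (length-topCodes F (next s a) as)

  length-leafCodes : ∀ s a → length (leafCodes s a) ≡ a
  length-leafCodes s a with parity? a
  ... | parity false h = length-range _ (h * 2)
  ... | parity true  h = cong suc (length-range _ (h * 2))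

  length-allLeafCodes : ∀ s as → length (allLeafCodes s as) ≡ sum as
  length-allLeafCodes s []       = refl
  length-allLeafCodes s (a ∷ as) =
    trans (length-++ (leafCodes s a)) (cong₂ _+_ (length-leafCodes s a) (length-allLeafCodes (next s a) as))

  topCodes-↭ : ∀ F s as → topCodes F s as ↭ map F (range (odds s) (oddCount as)) ++ range (evens s + evenBase) (evenCount as)
  topCodes-↭ F s []       = ↭-refl
  topCodes-↭ F s (a ∷ as) with parity? a
  ... | parity true  _ = prep _ (topCodes-↭ F _ as)
  ... | parity false _ = ↭-trans (prep _ (topCodes-↭ F _ as)) (↭-sym (shift _ (map F (range (odds s) (oddCount as))) _))

  private
    merge : ∀ t h k L → range ((t + pairBase) * 2) (h * 2) ++ (L ++ range ((t + h + pairBase) * 2) (k * 2))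
                        ↭ L ++ range ((t + pairBase) * 2) ((h + k) * 2)
    merge t h k L = ↭-trans (shifts (range X (h * 2)) L) (++⁺ˡ L (↭-reflexive (begin
      range X (h * 2) ++ range ((t + h + pairBase) * 2) (k * 2) ≡⟨ cong (λ y → range X (h * 2) ++ range y (k * 2)) (shuffle t h pairBase) ⟩
      range X (h * 2) ++ range (X + h * 2) (k * 2)               ≡⟨ range-++ X (h * 2) (k * 2) ⟩
      range X (h * 2 + k * 2)                                    ≡⟨ cong (range X) (*-distribʳ-+ 2 h k) ⟨
      range X ((h + k) * 2)                                      ∎)))
      where
      open ≡-Reasoning
      X : ℕ
      X = (t + pairBase) * 2
      shuffle : ∀ t h p → (t + h + p) * 2 ≡ (t + p) * 2 + h * 2
      shuffle = solve-∀

  allLeafCodes-↭ : ∀ s as → allLeafCodes s as ↭ map leafCode (range (odds s) (oddCount as)) ++ range ((pairs s + pairBase) * 2) (pairCount as * 2)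
  allLeafCodes-↭ s []       = ↭-refl
  allLeafCodes-↭ s (a ∷ as) with parity? a
  ... | parity false h = ↭-trans (++⁺ˡ (range _ (h * 2)) (allLeafCodes-↭ _ as)) (merge (pairs s) h (pairCount as) _)
  ... | parity true  h = prep _ (↭-trans (++⁺ˡ (range _ (h * 2)) (allLeafCodes-↭ _ as)) (merge (pairs s) h (pairCount as) _))

  Room : Counters → List ℕ → Set
  Room s as = odds s + oddCount as ≤ R * 2

  room-next : ∀ s a as → Room s (a ∷ as) → Room (next s a) as
  room-next s a as room with parity? a
  ... | parity false _ = room
  ... | parity true  _ = subst (_≤ R * 2) (+-suc (odds s) (oddCount as)) room

  child-sum : ∀ s a as → Room s (a ∷ as) →
              label (topCode rootCode s a) +ℤ sumℤ (map label (leafCodes s a)) ≡ label (topCode childCode s a)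
  child-sum s a as room with parity? a
  ... | parity false h = trans (cong (label (evens s + evenBase) +ℤ_) (range-sum (pairs s + pairBase) h)) (ℤ.+-identityʳ _)
  ... | parity true  h = begin
      label (rootCode w) +ℤ (label (leafCode w) +ℤ sumℤ (map label (range ((pairs s + pairBase) * 2) (h * 2))))
        ≡⟨ cong (λ z → label (rootCode w) +ℤ (label (leafCode w) +ℤ z)) (range-sum (pairs s + pairBase) h) ⟩
      label (rootCode w) +ℤ (label (leafCode w) +ℤ 0ℤ)
        ≡⟨ cong (label (rootCode w) +ℤ_) (ℤ.+-identityʳ _) ⟩
      label (rootCode w) +ℤ label (leafCode w)
        ≡⟨ odd-child-sum w (<-≤-trans (m<m+n w z<s) room) ⟩
      label (childCode w) ∎
    where
    open ≡-Reasoning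
    w : ℕ
    w = odds s

  rootCode-⟨⟩ : ∀ b x → rootCode ⟨ b , x ⟩ ≡ ⟨ b , x * 2 ⟩
  rootCode-⟨⟩ b x rewrite parity?-unique b x = refl

  -- The root edge labels sum to zero, so the root gets the label 0.
  root-sum : ∀ as → oddCount as ≡ R * 2 → evenCount as ≡ H * 2 → sumℤ (map label (topCodes rootCode start as)) ≡ 0ℤ
  root-sum as odd≡ even≡ = begin
    sumℤ (map label (topCodes rootCode start as))
      ≡⟨ sumℤ-↭ (↭-map⁺ label (topCodes-↭ rootCode start as)) ⟩
    sumℤ (map label (map rootCode (range 0 (oddCount as)) ++ range evenBase (evenCount as)))
      ≡⟨ trans (cong sumℤ (map-++ label (map rootCode (range 0 (oddCount as))) _)) (sumℤ-++ (map label (map rootCode (range 0 (oddCount as)))) _) ⟩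
    sumℤ (map label (map rootCode (range 0 (oddCount as)))) +ℤ sumℤ (map label (range evenBase (evenCount as)))
      ≡⟨ cong₂ _+ℤ_ (trans (cong (λ k → sumℤ (map label (map rootCode (range 0 k)))) odd≡) odd-part)
                    (trans (cong (λ k → sumℤ (map label (range evenBase k))) even≡) (range-sum (R * 2) H)) ⟩
    0ℤ ∎
    where
    open ≡-Reasoning
    opposite : ∀ x → label (rootCode ⟨ true , x ⟩) ≡ - label (rootCode ⟨ false , x ⟩)
    opposite x rewrite rootCode-⟨⟩ true x | rootCode-⟨⟩ false x | label-parity true (x * 2) | label-parity false (x * 2) = refl
    odd-part : sumℤ (map label (map rootCode (range 0 (R * 2)))) ≡ 0ℤ
    odd-part = trans (cong sumℤ (sym (map-∘ (range 0 (R * 2))))) (paired-sum rootCode opposite 0 R)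

  record OddCodes (F : ℕ → ℕ) : Set where
    field
      injective : ∀ {w w′} → w < R * 2 → w′ < R * 2 → F w ≡ F w′ → w ≡ w′
      ≢leaf     : ∀ w w′ → F w ≢ leafCode w′
      bound     : ∀ {w} → w < R * 2 → F w < evenBase

  rootCodes-ok : OddCodes rootCode
  rootCodes-ok = record { injective = λ _ _ → rootCode-injective ; ≢leaf = rootCode≢leafCode ; bound = rootCode-bound }

  childCodes-ok : OddCodes childCode
  childCodes-ok = record { injective = childCode-injective ; ≢leaf = childCode≢leafCode ; bound = childCode-bound }

  -- Up to order, the codes of all edges (F = rootCode) or of all non-root vertices
  -- (F = childCode): the odd block, then one block of the 2H + 2P remaining codes.
  layout : (ℕ → ℕ) → ℕ → List ℕ
  layout F P = (map F (range 0 (R * 2)) ++ map leafCode (range 0 (R * 2))) ++ range evenBase (H * 2 + P * 2)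

  codes-↭-layout : ∀ F as → oddCount as ≡ R * 2 → evenCount as ≡ H * 2 →
                   topCodes F start as ++ allLeafCodes start as ↭ layout F (pairCount as)
  codes-↭-layout F as odd≡ even≡ = ↭-trans (↭-++⁺ (topCodes-↭ F start as) (allLeafCodes-↭ start as)) (rearranged)
    where
    A : List ℕ
    A = map F (range 0 (R * 2))
    B : List ℕ
    B = map leafCode (range 0 (R * 2))
    E : List ℕ
    E = range evenBase (H * 2)
    P : ℕ
    P = pairCount as
    blocks : range evenBase (H * 2) ++ range (pairBase * 2) (P * 2) ≡ range evenBase (H * 2 + P * 2)
    blocks = trans (cong (λ x → E ++ range x (P * 2)) (*-distribʳ-+ 2 (R * 2) H)) (range-++ evenBase (H * 2) (P * 2))
    rearranged : (map F (range 0 (oddCount as)) ++ range evenBase (evenCount as)) ++ (map leafCode (range 0 (oddCount as)) ++ range (pairBase * 2) (P * 2))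
                             ↭ layout F P
    rearranged rewrite odd≡ | even≡ =
      ↭-trans (↭-reflexive (++-assoc A E _))
      (↭-trans (++⁺ˡ A (shifts E B))
      (↭-reflexive (trans (sym (++-assoc A B _)) (cong ((A ++ B) ++_) blocks))))

  module _ {F} (ok : OddCodes F) (P : ℕ) where
    open OddCodes ok

    private
      odd-block-bound : ∀ {v} → v ∈ map F (range 0 (R * 2)) ++ map leafCode (range 0 (R * 2)) → v < evenBase
      odd-block-bound v∈ with ∈-++⁻ (map F (range 0 (R * 2))) v∈
      ... | inj₁ v∈F with ∈-map⁻ F v∈F
      ...   | w , w∈ , refl = bound (proj₂ (∈-range⁻ w∈))
      odd-block-bound v∈ | inj₂ v∈L with ∈-map⁻ leafCode v∈L
      ...   | w , w∈ , refl = leafCode-bound (proj₂ (∈-range⁻ w∈))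

    layout-unique : Unique (layout F P)
    layout-unique = unique-++-separated
      (++⁺ (unique-map F (λ x∈ y∈ → injective (proj₂ (∈-range⁻ x∈)) (proj₂ (∈-range⁻ y∈))) (range-unique 0 (R * 2)))
           (unique-map leafCode (λ x∈ y∈ → leafCode-injective (proj₂ (∈-range⁻ x∈)) (proj₂ (∈-range⁻ y∈))) (range-unique 0 (R * 2)))
           disjoint)
      (range-unique evenBase (H * 2 + P * 2))
      (All.tabulate odd-block-bound)
      (All.tabulate (λ v∈ → proj₁ (∈-range⁻ v∈)))
      where
      disjoint : ∀ {v} → ¬ (v ∈ map F (range 0 (R * 2)) × v ∈ map leafCode (range 0 (R * 2)))
      disjoint (v∈F , v∈L) with ∈-map⁻ F v∈F | ∈-map⁻ leafCode v∈L
      ... | w , _ , refl | w′ , _ , Fw≡leaf = ≢leaf w w′ Fw≡leaf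

    layout-bound : All (_< (R * 2 + H + P) * 2) (layout F P)
    layout-bound = All.tabulate bounded
      where
      total : evenBase + (H * 2 + P * 2) ≡ (R * 2 + H + P) * 2
      total = arith R H P
        where
        arith : ∀ R H P → R * 2 * 2 + (H * 2 + P * 2) ≡ (R * 2 + H + P) * 2
        arith = solve-∀
      bounded : ∀ {v} → v ∈ layout F P → v < (R * 2 + H + P) * 2
      bounded v∈ with ∈-++⁻ (map F (range 0 (R * 2)) ++ map leafCode (range 0 (R * 2))) v∈
      ... | inj₁ v∈odd  = ≤-trans (odd-block-bound v∈odd) (≤-trans (m≤m+n evenBase _) (≤-reflexive total))
      ... | inj₂ v∈rest = ≤-trans (proj₂ (∈-range⁻ v∈rest)) (≤-reflexive total)

    length-layout : length (layout F P) ≡ (R * 2 + H + P) * 2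
    length-layout = begin
      length (layout F P) ≡⟨ length-++ (map F (range 0 (R * 2)) ++ _) ⟩
      length (map F (range 0 (R * 2)) ++ map leafCode (range 0 (R * 2))) + length (range evenBase (H * 2 + P * 2))
        ≡⟨ cong₂ _+_ (trans (length-++ (map F (range 0 (R * 2)))) (cong₂ _+_ (odd-length F) (odd-length leafCode))) (length-range evenBase _) ⟩
      R * 2 + R * 2 + (H * 2 + P * 2) ≡⟨ arith R H P ⟩
      (R * 2 + H + P) * 2 ∎
      where
      open ≡-Reasoning
      odd-length : ∀ G → length (map G (range 0 (R * 2))) ≡ R * 2
      odd-length G = trans (length-map G (range 0 (R * 2))) (length-range 0 (R * 2))
      arith : ∀ R H P → R * 2 + R * 2 + (H * 2 + P * 2) ≡ (R * 2 + H + P) * 2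
      arith = solve-∀

  leafEntries : ℕ → Counters → List ℕ → ParentList
  leafEntries i s []       = []
  leafEntries i s (a ∷ as) = fan i (map label (leafCodes s a)) ++ leafEntries (suc i) (next s a) as

  rootLabels : List ℕ → List ℤ
  rootLabels as = map label (topCodes rootCode start as)

  rootEntries : List ℕ → ParentList
  rootEntries as = fan 0 (rootLabels as)

  treeEntries : List ℕ → ParentList
  treeEntries as = rootEntries as ++ leafEntries 1 start as

  edgeCodes vertexCodes : List ℕ → List ℕ
  edgeCodes   as = topCodes rootCode start as ++ allLeafCodes start as
  vertexCodes as = topCodes childCode start as ++ allLeafCodes start as

  private
    length-leafBlock : ∀ i s a → length (fan i (map label (leafCodes s a))) ≡ a
    length-leafBlock i s a = trans (length-map _ (map label (leafCodes s a))) (trans (length-map label (leafCodes s a)) (length-leafCodes s a))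

    length-rootEntries : ∀ as → length (rootEntries as) ≡ length as
    length-rootEntries as = trans (length-map _ (map label (topCodes rootCode start as)))
      (trans (length-map label (topCodes rootCode start as)) (length-topCodes rootCode start as))

  leafEntries-edges : ∀ i n s as → attachedEdges n (leafEntries i s as) ≡ leafEdges i n as
  leafEntries-edges i n s []       = refl
  leafEntries-edges i n s (a ∷ as) = begin
    attachedEdges n (block ++ rest)                                  ≡⟨ attachedEdges-++ n block rest ⟩
    attachedEdges n block ++ attachedEdges (n + length block) rest   ≡⟨ cong₂ _++_ siblings later ⟩
    map (λ t → (i , n + t)) (upTo a) ++ leafEdges (suc i) (n + a) as ∎
    where
    open ≡-Reasoning
    block : ParentList
    block = fan i (map label (leafCodes s a))
    rest : ParentList
    rest = leafEntries (suc i) (next s a) as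
    siblings : attachedEdges n block ≡ map (λ t → (i , n + t)) (upTo a)
    siblings = trans (attachedEdges-fan n i _) (cong (λ k → map (λ t → (i , n + t)) (upTo k))
                 (trans (length-map label (leafCodes s a)) (length-leafCodes s a)))
    later : attachedEdges (n + length block) rest ≡ leafEdges (suc i) (n + a) as
    later = trans (cong (λ k → attachedEdges (n + k) rest) (length-leafBlock i s a)) (leafEntries-edges (suc i) (n + a) (next s a) as)

  tree-edges : ∀ as → attachedEdges 1 (treeEntries as) ≡ edges (RT as)
  tree-edges as = trans (attachedEdges-++ 1 (rootEntries as) (leafEntries 1 start as)) (cong₂ _++_ roots leaves)
    where
    roots : attachedEdges 1 (rootEntries as) ≡ map (λ t → (0 , suc t)) (upTo (length as))
    roots = trans (attachedEdges-fan 1 0 _) (cong (λ k → map (λ t → (0 , suc t)) (upTo k))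
              (trans (length-map label (topCodes rootCode start as)) (length-topCodes rootCode start as)))
    leaves : attachedEdges (1 + length (rootEntries as)) (leafEntries 1 start as) ≡ leafEdges 1 (1 + length as) as
    leaves = trans (cong (λ k → attachedEdges (1 + k) (leafEntries 1 start as)) (length-rootEntries as)) (leafEntries-edges 1 _ start as)

  tree-labels : ∀ as → map proj₂ (treeEntries as) ≡ map label (edgeCodes as)
  tree-labels as = trans (map-++ proj₂ (rootEntries as) _)
    (trans (cong₂ _++_ (map-proj₂-fan 0 _) (leaves 1 start as)) (sym (map-++ label (topCodes rootCode start as) _)))
    where
    leaves : ∀ i s as → map proj₂ (leafEntries i s as) ≡ map label (allLeafCodes s as)
    leaves i s []       = refl
    leaves i s (a ∷ as) = trans (map-++ proj₂ (fan i (map label (leafCodes s a))) _)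
      (trans (cong₂ _++_ (map-proj₂-fan i _) (leaves (suc i) (next s a) as)) (sym (map-++ label (leafCodes s a) _)))

  leafEntries-parents : ∀ i s as {e} → e ∈ leafEntries i s as → i ≤ proj₁ e × proj₁ e < i + length as
  leafEntries-parents i s (a ∷ as) {e} e∈ with ∈-++⁻ (fan i (map label (leafCodes s a))) e∈
  ... | inj₁ e∈block with ∈-map⁻ (λ (z : ℤ) → (i , z)) e∈block
  ...   | _ , _ , refl = ≤-refl , ≤-trans (s≤s (m≤m+n i (length as))) (≤-reflexive (sym (+-suc i (length as))))
  leafEntries-parents i s (a ∷ as) {e} e∈ | inj₂ e∈rest =
    let i<p , p< = leafEntries-parents (suc i) (next s a) as e∈rest in <⇒≤ i<p , subst (proj₁ e <_) (sym (+-suc i (length as))) p<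

  tree-parentsFirst : ∀ as → ParentsFirst 1 (treeEntries as)
  tree-parentsFirst as = ParentsFirst-++ (rootEntries as) _
    (ParentsFirst-bounded _ (All.tabulate root-parent))
    (ParentsFirst-bounded _ (All.tabulate (λ {e} e∈ →
      subst (λ k → proj₁ e < suc k) (sym (length-rootEntries as)) (proj₂ (leafEntries-parents 1 start as e∈)))))
    where
    root-parent : ∀ {e} → e ∈ rootEntries as → proj₁ e < 1
    root-parent e∈ with ∈-map⁻ (λ (z : ℤ) → (0 , z)) e∈
    ... | _ , _ , refl = s≤s z≤n

  child-leaves : ∀ i s as x → x < length as → Room s as →
                 label (at 0 (topCodes rootCode s as) x) +ℤ childSum (leafEntries i s as) (i + x) ≡ label (at 0 (topCodes childCode s as) x)
  child-leaves i s (a ∷ as) zero _ room = begin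
    label (topCode rootCode s a) +ℤ childSum (block ++ rest) (i + 0)
      ≡⟨ cong (λ v → label (topCode rootCode s a) +ℤ childSum (block ++ rest) v) (+-identityʳ i) ⟩
    label (topCode rootCode s a) +ℤ childSum (block ++ rest) i
      ≡⟨ cong (label (topCode rootCode s a) +ℤ_) (childSum-++ block rest i) ⟩
    label (topCode rootCode s a) +ℤ (childSum block i +ℤ childSum rest i)
      ≡⟨ cong (λ z → label (topCode rootCode s a) +ℤ (z +ℤ childSum rest i)) (childSum-fan i (map label (leafCodes s a))) ⟩
    label (topCode rootCode s a) +ℤ (sumℤ (map label (leafCodes s a)) +ℤ childSum rest i)
      ≡⟨ cong (λ z → label (topCode rootCode s a) +ℤ (sumℤ (map label (leafCodes s a)) +ℤ z)) rest-none ⟩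
    label (topCode rootCode s a) +ℤ (sumℤ (map label (leafCodes s a)) +ℤ 0ℤ)
      ≡⟨ cong (label (topCode rootCode s a) +ℤ_) (ℤ.+-identityʳ _) ⟩
    label (topCode rootCode s a) +ℤ sumℤ (map label (leafCodes s a))
      ≡⟨ child-sum s a as room ⟩
    label (topCode childCode s a) ∎
    where
    open ≡-Reasoning
    block : ParentList
    block = fan i (map label (leafCodes s a))
    rest : ParentList
    rest = leafEntries (suc i) (next s a) as
    rest-none : childSum rest i ≡ 0ℤ
    rest-none = childSum-none rest i (All.tabulate (λ e∈ p≡i → <-irrefl (sym p≡i) (proj₁ (leafEntries-parents (suc i) (next s a) as e∈))))
  child-leaves i s (a ∷ as) (suc x) (s≤s x<n) room = begin
    label (at 0 (topCodes rootCode (next s a) as) x) +ℤ childSum (block ++ rest) (i + suc x)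
      ≡⟨ cong (label (at 0 (topCodes rootCode (next s a) as) x) +ℤ_) (childSum-++ block rest (i + suc x)) ⟩
    label (at 0 (topCodes rootCode (next s a) as) x) +ℤ (childSum block (i + suc x) +ℤ childSum rest (i + suc x))
      ≡⟨ cong (λ z → label (at 0 (topCodes rootCode (next s a) as) x) +ℤ (z +ℤ childSum rest (i + suc x)))
              (childSum-fan-other i (map label (leafCodes s a)) (i + suc x) (λ i≡ → m+1+n≢m i (sym i≡))) ⟩
    label (at 0 (topCodes rootCode (next s a) as) x) +ℤ (0ℤ +ℤ childSum rest (i + suc x))
      ≡⟨ cong (λ z → label (at 0 (topCodes rootCode (next s a) as) x) +ℤ z) (trans (ℤ.+-identityˡ _) (cong (childSum rest) (+-suc i x))) ⟩
    label (at 0 (topCodes rootCode (next s a) as) x) +ℤ childSum rest (suc i + x)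
      ≡⟨ child-leaves (suc i) (next s a) as x x<n (room-next s a as room) ⟩
    label (at 0 (topCodes childCode (next s a) as) x) ∎
    where
    open ≡-Reasoning
    block : ParentList
    block = fan i (map label (leafCodes s a))
    rest : ParentList
    rest = leafEntries (suc i) (next s a) as

  vertexSum : List ℕ → ℕ → ℤ
  vertexSum as v = ownLabel 1 (treeEntries as) v +ℤ childSum (treeEntries as) v

  length-codes : ∀ F as → length (topCodes F start as ++ allLeafCodes start as) ≡ length as + sum as
  length-codes F as = trans (length-++ (topCodes F start as)) (cong₂ _+_ (length-topCodes F start as) (length-allLeafCodes start as))

  private
    at-top : ∀ F as {x} → x < length as → at 0 (topCodes F start as ++ allLeafCodes start as) x ≡ at 0 (topCodes F start as) x
    at-top F as x<n = at-++ˡ (topCodes F start as) _ (subst (_ <_) (sym (length-topCodes F start as)) x<n)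

    at-leaf : ∀ F as k → at 0 (topCodes F start as ++ allLeafCodes start as) (length as + k) ≡ at 0 (allLeafCodes start as) k
    at-leaf F as k = trans (cong (λ n → at 0 (topCodes F start as ++ allLeafCodes start as) (n + k)) (sym (length-topCodes F start as)))
                           (at-++ʳ (topCodes F start as) _ k)

    own-edge : ∀ as x → x < length as + sum as → ownLabel 1 (treeEntries as) (suc x) ≡ label (at 0 (edgeCodes as) x)
    own-edge as x x< = trans (ownLabel-at 1 (treeEntries as) x)
      (trans (cong (λ L → at 0ℤ L x) (tree-labels as)) (at-map label (edgeCodes as) (subst (x <_) (sym (length-codes rootCode as)) x<)))

  root-vertex : ∀ as → oddCount as ≡ R * 2 → evenCount as ≡ H * 2 → vertexSum as 0 ≡ 0ℤ
  root-vertex as odd≡ even≡ = begin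
    ownLabel 1 (treeEntries as) 0 +ℤ childSum (treeEntries as) 0
      ≡⟨ cong₂ _+ℤ_ (ownLabel-before 1 (treeEntries as) 0 (s≤s z≤n)) (childSum-++ (rootEntries as) _ 0) ⟩
    0ℤ +ℤ (childSum (rootEntries as) 0 +ℤ childSum (leafEntries 1 start as) 0)
      ≡⟨ ℤ.+-identityˡ _ ⟩
    childSum (rootEntries as) 0 +ℤ childSum (leafEntries 1 start as) 0
      ≡⟨ cong₂ _+ℤ_ (trans (childSum-fan 0 (rootLabels as)) (root-sum as odd≡ even≡)) leaves-none ⟩
    0ℤ ∎
    where
    open ≡-Reasoning
    leaves-none : childSum (leafEntries 1 start as) 0 ≡ 0ℤ
    leaves-none = childSum-none _ 0 (All.tabulate (λ e∈ p≡0 → <-irrefl (sym p≡0) (proj₁ (leafEntries-parents 1 start as e∈))))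

  child-vertex : ∀ as → Room start as → ∀ x → x < length as → vertexSum as (suc x) ≡ label (at 0 (vertexCodes as) x)
  child-vertex as room x x<n = begin
    ownLabel 1 (treeEntries as) (suc x) +ℤ childSum (rootEntries as ++ leafEntries 1 start as) (suc x)
      ≡⟨ cong₂ _+ℤ_ (trans (own-edge as x (≤-trans x<n (m≤m+n _ _))) (cong label (at-top rootCode as x<n)))
                    (childSum-++ (rootEntries as) _ (suc x)) ⟩
    label (at 0 (topCodes rootCode start as) x) +ℤ (childSum (rootEntries as) (suc x) +ℤ childSum (leafEntries 1 start as) (suc x))
      ≡⟨ cong (λ z → label (at 0 (topCodes rootCode start as) x) +ℤ (z +ℤ childSum (leafEntries 1 start as) (suc x)))
              (childSum-fan-other 0 (rootLabels as) (suc x) (λ ())) ⟩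
    label (at 0 (topCodes rootCode start as) x) +ℤ (0ℤ +ℤ childSum (leafEntries 1 start as) (1 + x))
      ≡⟨ cong (label (at 0 (topCodes rootCode start as) x) +ℤ_) (ℤ.+-identityˡ _) ⟩
    label (at 0 (topCodes rootCode start as) x) +ℤ childSum (leafEntries 1 start as) (1 + x)
      ≡⟨ child-leaves 1 start as x x<n room ⟩
    label (at 0 (topCodes childCode start as) x)
      ≡⟨ cong label (at-top childCode as x<n) ⟨
    label (at 0 (vertexCodes as) x) ∎
    where open ≡-Reasoning

  leaf-vertex : ∀ as k → k < sum as → vertexSum as (suc (length as + k)) ≡ label (at 0 (vertexCodes as) (length as + k))
  leaf-vertex as k k<S = begin
    ownLabel 1 (treeEntries as) (suc v) +ℤ childSum (rootEntries as ++ leafEntries 1 start as) (suc v)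
      ≡⟨ cong₂ _+ℤ_ (trans (own-edge as v (+-monoʳ-< (length as) k<S)) (cong label (at-leaf rootCode as k)))
                    (trans (childSum-++ (rootEntries as) _ (suc v)) (cong₂ _+ℤ_ (childSum-fan-other 0 (rootLabels as) (suc v) (λ ())) leaves-none)) ⟩
    label (at 0 (allLeafCodes start as) k) +ℤ 0ℤ
      ≡⟨ ℤ.+-identityʳ _ ⟩
    label (at 0 (allLeafCodes start as) k)
      ≡⟨ cong label (at-leaf childCode as k) ⟨
    label (at 0 (vertexCodes as) v) ∎
    where
    open ≡-Reasoning
    v : ℕ
    v = length as + k
    leaves-none : childSum (leafEntries 1 start as) (suc v) ≡ 0ℤ
    leaves-none = childSum-none _ (suc v) (All.tabulate (λ e∈ p≡ →
      <-irrefl p≡ (≤-trans (proj₂ (leafEntries-parents 1 start as e∈)) (s≤s (m≤m+n (length as) k)))))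

  nonroot-vertex : ∀ as → Room start as → ∀ x → x < length as + sum as → vertexSum as (suc x) ≡ label (at 0 (vertexCodes as) x)
  nonroot-vertex as room x x< with x <? length as
  ... | yes x<n = child-vertex as room x x<n
  ... | no  x≮n with m≤n⇒∃[o]m+o≡n (≮⇒≥ x≮n)
  ...   | k , refl = leaf-vertex as k (+-cancelˡ-< (length as) k (sum as) x<)

module Labelling (as : List ℕ) (R H : ℕ) (odd≡ : oddCount as ≡ R * 2) (even≡ : evenCount as ≡ H * 2) where
  open Scheme R H

  M : ℕ
  M = R * 2 + H + pairCount as
  T : ParentList
  T = treeEntries as
  EC VC : List ℕ
  EC = edgeCodes as
  VC = 0 ∷ map suc (vertexCodes as)

  EC↭ : EC ↭ layout rootCode (pairCount as)
  EC↭ = codes-↭-layout rootCode as odd≡ even≡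
  VC↭ : vertexCodes as ↭ layout childCode (pairCount as)
  VC↭ = codes-↭-layout childCode as odd≡ even≡

  size≡ : size (RT as) ≡ length EC
  size≡ = begin
    length (edges (RT as))       ≡⟨ cong length (tree-edges as) ⟨
    length (attachedEdges 1 T)   ≡⟨ trans (length-map proj₁ (attach 1 T)) (length-attach 1 T) ⟩
    length T                     ≡⟨ length-map proj₂ T ⟨
    length (map proj₂ T)         ≡⟨ cong length (tree-labels as) ⟩
    length (map label EC)        ≡⟨ length-map label EC ⟩
    length EC                    ∎
    where open ≡-Reasoning

  size≡2M : size (RT as) ≡ M * 2
  size≡2M = trans size≡ (trans (↭-length EC↭) (length-layout rootCodes-ok (pairCount as)))

  order≡ : order (RT as) ≡ length VC
  order≡ = cong suc (sym (trans (length-map suc (vertexCodes as)) (length-codes childCode as)))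

  order≡1+2M : order (RT as) ≡ suc (M * 2)
  order≡1+2M = trans order≡ (cong suc (trans (length-map suc (vertexCodes as)) (trans (↭-length VC↭) (length-layout childCodes-ok (pairCount as)))))

  edgeLabelling : Fin (size (RT as)) → ℤ
  edgeLabelling i = label (lookup EC (cast size≡ i))

  edge-bijection : BijOntoLabels (size (RT as)) edgeLabelling
  edge-bijection = codes⇒bijection (subst (λ m → Coding m label) (sym size≡2M) (label-coding M)) EC size≡
    (unique-resp-↭ (↭-sym EC↭) (layout-unique rootCodes-ok (pairCount as)))
    (subst (λ m → All (_< m) EC) (sym size≡2M) (All-resp-↭ (↭-sym EC↭) (layout-bound rootCodes-ok (pairCount as))))

  vertexLabelling : Fin (order (RT as)) → ℤ
  vertexLabelling v = label₀ (lookup VC (cast order≡ v))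

  vertex-bijection : BijOntoLabels (order (RT as)) vertexLabelling
  vertex-bijection = codes⇒bijection (subst (λ m → Coding m label₀) (sym order≡1+2M) (label₀-coding M)) VC order≡
    (All.tabulate 0∉ ∷ unique-map⁺ suc-injective (unique-resp-↭ (↭-sym VC↭) (layout-unique childCodes-ok (pairCount as))))
    (subst (λ m → All (_< m) VC) (sym order≡1+2M)
      (s≤s z≤n ∷ All-map⁺ (All.map s≤s (All-resp-↭ (↭-sym VC↭) (layout-bound childCodes-ok (pairCount as))))))
    where
    0∉ : ∀ {x} → x ∈ map suc (vertexCodes as) → 0 ≢ x
    0∉ x∈ 0≡x with ∈-map⁻ suc x∈
    ... | _ , _ , refl = 0≢1+n 0≡x

  vertex-sums : ∀ v → v < order (RT as) → vertexSum as v ≡ label₀ (at 0 VC v)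
  vertex-sums zero    _          = root-vertex as odd≡ even≡
  vertex-sums (suc x) (s≤s x<n) = trans (nonroot-vertex as (≤-reflexive odd≡) x x<n)
    (cong label₀ (sym (at-map suc (vertexCodes as) (subst (x <_) (sym (length-codes childCode as)) x<n))))

  vertexLabel≡ : ∀ v → vertexLabel (RT as) edgeLabelling v ≡ vertexLabelling v
  vertexLabel≡ v = begin
    incSum (edges (RT as)) edgeLabelling (toℕ v)         ≡⟨ incSum-zip (edges (RT as)) EC label size≡ (toℕ v) ⟩
    incidence (zip (edges (RT as)) (map label EC)) (toℕ v) ≡⟨ cong (λ es → incidence es (toℕ v)) attached ⟩
    incidence (attach 1 T) (toℕ v)                       ≡⟨ incidence-attach 1 T (toℕ v) (tree-parentsFirst as) ⟩
    vertexSum as (toℕ v)                                 ≡⟨ vertex-sums (toℕ v) (toℕ<n v) ⟩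
    label₀ (at 0 VC (toℕ v))                             ≡⟨ cong label₀ position ⟩
    vertexLabelling v                                    ∎
    where
    open ≡-Reasoning
    position : at 0 VC (toℕ v) ≡ lookup VC (cast order≡ v)
    position = trans (cong (at 0 VC) (sym (toℕ-cast order≡ v))) (at-lookup VC (cast order≡ v))
    attached : zip (edges (RT as)) (map label EC) ≡ attach 1 T
    attached = trans (cong₂ zip (sym (tree-edges as)) (sym (tree-labels as))) (zip-attach 1 T)

RT-super-edge-graceful : ∀ as R H → oddCount as ≡ R * 2 → evenCount as ≡ H * 2 → SuperEdgeGraceful (RT as)
RT-super-edge-graceful as R H odd≡ even≡ = edgeLabelling , edge-bijection , BijOntoLabels-resp vertexLabel≡ vertex-bijection
  where open Labelling as R H odd≡ even≡

bit%2 : ∀ b h → (bit b + h * 2) % 2 ≡ bit b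
bit%2 false h = [m+kn]%n≡m%n 0 h 2
bit%2 true  h = [m+kn]%n≡m%n 1 h 2

countOdd-∷ : ∀ a as → countOdd (a ∷ as) ≡ a % 2 + countOdd as
countOdd-∷ a as with a % 2 | m%n<n a 2
... | zero          | _ = refl
... | suc zero      | _ = refl
... | suc (suc _)   | s≤s (s≤s ())

countEven-∷ : ∀ a as → countZero (a ∷ as) + countPosEven (a ∷ as) ≡ (1 ∸ a % 2) + (countZero as + countPosEven as)
countEven-∷ zero    as = refl
countEven-∷ (suc a) as with suc a % 2 | m%n<n (suc a) 2
... | zero        | _ = +-suc (countZero as) (countPosEven as)
... | suc zero    | _ = refl
... | suc (suc _) | s≤s (s≤s ())

oddCount≡countOdd : ∀ as → oddCount as ≡ countOdd as
oddCount≡countOdd []       = refl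
oddCount≡countOdd (a ∷ as) with parity? a
... | parity false h = trans (oddCount≡countOdd as) (sym (trans (countOdd-∷ (h * 2) as) (cong (_+ countOdd as) (bit%2 false h))))
... | parity true  h = trans (cong suc (oddCount≡countOdd as)) (sym (trans (countOdd-∷ (suc (h * 2)) as) (cong (_+ countOdd as) (bit%2 true h))))

evenCount≡countEven : ∀ as → evenCount as ≡ countZero as + countPosEven as
evenCount≡countEven []       = refl
evenCount≡countEven (a ∷ as) with parity? a
... | parity false h = trans (cong suc (evenCount≡countEven as))
                         (sym (trans (countEven-∷ (h * 2) as) (cong (λ r → (1 ∸ r) + (countZero as + countPosEven as)) (bit%2 false h))))
... | parity true  h = trans (evenCount≡countEven as)
                         (sym (trans (countEven-∷ (suc (h * 2)) as) (cong (λ r → (1 ∸ r) + (countZero as + countPosEven as)) (bit%2 true h))))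

even-half : ∀ n → n % 2 ≡ 0 → n ≡ n / 2 * 2
even-half n n-even = trans (m≡m%n+[m/n]*n n 2) (cong (_+ n / 2 * 2) n-even)

odd+odd-half : ∀ m n → m % 2 ≡ 1 → n % 2 ≡ 1 → m + n ≡ suc (m / 2 + n / 2) * 2
odd+odd-half m n m-odd n-odd = begin
  m + n                                 ≡⟨ cong₂ _+_ (trans (m≡m%n+[m/n]*n m 2) (cong (_+ m / 2 * 2) m-odd))
                                                     (trans (m≡m%n+[m/n]*n n 2) (cong (_+ n / 2 * 2) n-odd)) ⟩
  (1 + m / 2 * 2) + (1 + n / 2 * 2)     ≡⟨ arith (m / 2) (n / 2) ⟩
  suc (m / 2 + n / 2) * 2               ∎
  where
  open ≡-Reasoning
  arith : ∀ x y → (1 + x * 2) + (1 + y * 2) ≡ suc (x + y) * 2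
  arith = solve-∀

-- Lemma 11.  With j zero, k positive even and l odd child sizes, j and k odd and l even,
-- there are l = 2R odd children and j + k = 2H even ones, so RT(a₁,…,aₙ) is super
-- edge-graceful.
lemma11 : (as : List ℕ) (j k l : ℕ) →
    j ≡ countZero as → k ≡ countPosEven as → l ≡ countOdd as →
    j % 2 ≡ 1 → k % 2 ≡ 1 → l % 2 ≡ 0 → 3 ≤ k + l →
    SuperEdgeGraceful (RT as)
lemma11 as j k l j≡ k≡ l≡ j-odd k-odd l-even _ =
  RT-super-edge-graceful as (l / 2) (suc (j / 2 + k / 2)) odd≡ even≡
  where
  odd≡ : oddCount as ≡ l / 2 * 2
  odd≡ = trans (oddCount≡countOdd as) (trans (sym l≡) (even-half l l-even))
  even≡ : evenCount as ≡ suc (j / 2 + k / 2) * 2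
  even≡ = trans (evenCount≡countEven as) (trans (cong₂ _+_ (sym j≡) (sym k≡)) (odd+odd-half j k j-odd k-odd))
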